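{- Let $n>2$ and consider the directed circulant graph $C_n^+(1,2)$. No primitive pseudo orbit of length $l$ with $0<l\le n$ has any self-intersection; that is, in every such pseudo orbit each vertex is visited at most once in total.
   Context: $C_n^+(1,2)$ is the directed graph with vertex set $\{0,1,\dots,n-1\}$ (identified with $\mathbb{Z}/n\mathbb{Z}$) whose bonds are $(v,v+1 \bmod n)$ and $(v,v+2\bmod n)$ for every vertex $v$. A circuit of length $l\ge1$ is a sequence of vertices $v_0,\dots,v_l$ with $v_l=v_0$ and each $(v_i,v_{i+1})$ a bond. A periodic orbit is an equivalence class of circuits under cyclic rotation; its length is the length of any of its circuits; it is primitive if it is not a shorter periodic orbit repeated several times. A pseudo orbit is a finite collection of periodic orbits; its length is the sum of the lengths of its periodic orbits; it is primitive if it consists only of primitive periodic orbits, none repeated. A periodic orbit of length $k$ with circuit $v_0,\dots,v_{k}=v_0$ visits the vertices $v_0,\dots,v_{k-1}$ (with multiplicity); the visits of a pseudo orbit are the visits of all its periodic orbits together. A self-intersection ($\ell$-encounter) is a maximal sequence of consecutive vertices (with the bonds between them) that occurs $\ell\ge2$ times in the pseudo orbit, whether within one periodic orbit or across several; a pseudo orbit has no self-intersection exactly when no vertex is visited more than once. -}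

module Defs where

open import Data.Nat using (ℕ; _+_; _≤_; _<_)
open import Data.Fin using (Fin; toℕ)
open import Data.List using (List; []; _∷_; _++_; concat; replicate; drop; take; length; map)
open import Data.Nat.ListAction using (sum)
open import Data.List.Relation.Unary.All using (All)
open import Data.List.Relation.Unary.AllPairs using (AllPairs)
open import Data.Product using (_×_; ∃-syntax)
open import Data.Sum using (_⊎_)
open import Data.Unit using (⊤)
open import Data.Empty using (⊥)
open import Relation.Nullary using (¬_)
open import Relation.Binary.PropositionalEquality using (_≡_)

-- Vertices of C_n^+(1,2) are Fin n (= ℤ/nℤ).
-- v ≡ u + s (mod n), for u, v < n and s < n: either no wrap-around or one wrap-around.
AddMod : (n : ℕ) → ℕ → Fin n → Fin n → Set
AddMod n s u v = toℕ v ≡ toℕ u + s ⊎ toℕ v + n ≡ toℕ u + s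

Bond : (n : ℕ) → Fin n → Fin n → Set
Bond n u v = AddMod n 1 u v ⊎ AddMod n 2 u v

ConsecBonds : (n : ℕ) → List (Fin n) → Set
ConsecBonds n [] = ⊤
ConsecBonds n (x ∷ []) = ⊤
ConsecBonds n (x ∷ y ∷ r) = Bond n x y × ConsecBonds n (y ∷ r)

-- A circuit v_0 … v_l = v_0 is represented by the list of its visits
-- [v_0, …, v_{l-1}] (length l ≥ 1); closing bond (v_{l-1}, v_0) included.
IsCircuit : (n : ℕ) → List (Fin n) → Set
IsCircuit n [] = ⊥
IsCircuit n (v ∷ vs) = ConsecBonds n ((v ∷ vs) ++ (v ∷ []))

-- two circuits represent the same periodic orbit: cyclic rotation
RotEq : {A : Set} → List A → List A → Set
RotEq c d = ∃[ i ] (d ≡ drop i c ++ take i c)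

Primitive : {A : Set} → List A → Set
Primitive {A} c = ∀ (p : List A) (m : ℕ) → 2 ≤ m → ¬ (c ≡ concat (replicate m p))

-- A primitive pseudo orbit of C_n^+(1,2): a finite collection (list of
-- representative circuits) of primitive periodic orbits, none repeated.
record PrimitivePseudoOrbit (n : ℕ) (γ : List (List (Fin n))) : Set where
  field
    circuits  : All (IsCircuit n) γ
    allPrimitive : All Primitive γ
    distinct  : AllPairs (λ c d → ¬ RotEq c d) γ

orbitLength : {n : ℕ} → List (List (Fin n)) → ℕ
orbitLength γ = sum (map length γ)

visits : {n : ℕ} → List (List (Fin n)) → List (Fin n)
visits γ = concat γ

-- Lift every bond u → v to an integer step s ∈ {1, 2} with v ≡ u + s (mod n).
-- Along a closed walk of length k the steps add up to a positive multiple of n,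
-- so n ≤ (sum of steps) ≤ 2k.  Hence two closed walks through a common vertex
-- of total length at most n both have length n/2 and take only +2 steps, so
-- they coincide.  A vertex repeated inside one circuit therefore makes it the
-- square of a shorter circuit, and a vertex shared by two circuits makes them
-- rotations of each other; both are excluded in a primitive pseudo orbit.
module Submission where

open import Defs
open import Data.Nat using (ℕ; _<_; _≤_)
open import Data.Fin using (Fin)
open import Data.List using (List)
open import Data.List.Relation.Unary.Unique.Propositional using (Unique)

open import Data.Nat using (zero; suc; _+_; _*_; z≤n; s≤s; ⌊_/2⌋; _≟_)
open import Data.Nat.Properties
open import Data.Nat.Tactic.RingSolver using (solve-∀)
open import Data.Fin using (toℕ)
open import Data.Fin.Properties using (toℕ-injective; toℕ<n)
open import Data.List using ([]; _∷_; _++_; concat; replicate; drop; take; length)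
open import Data.List.Properties
  using (∷-injective; ++-assoc; ++-identityʳ; ∷ʳ-injectiveˡ; length-++; length-++-sucʳ; length-++-comm)
open import Data.List.Relation.Unary.All as All using (All; []; _∷_)
open import Data.List.Relation.Unary.AllPairs using (AllPairs; []; _∷_)
open import Data.List.Relation.Unary.Any using (here; there)
open import Data.List.Membership.Propositional using (_∈_)
open import Data.List.Membership.Propositional.Properties using (∈-∃++; ∈-concat⁻′)
import Data.List.Relation.Unary.Unique.Propositional.Properties as Unique
open import Data.Product using (_×_; _,_; proj₁; proj₂; ∃-syntax)
open import Data.Sum using (_⊎_; inj₁; inj₂)
open import Data.Unit using (tt)
open import Data.Empty using (⊥-elim)
open import Relation.Nullary using (¬_; Dec; yes; no)
open import Relation.Nullary.Decidable using (_⊎-dec_)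
open import Relation.Binary.PropositionalEquality

module _ {A : Set} where

  Repeats : List A → Set
  Repeats xs = ∃[ P ] ∃[ v ] ∃[ B ] ∃[ C ] xs ≡ P ++ v ∷ B ++ v ∷ C

  ¬Repeats⇒Unique : ∀ xs → ¬ Repeats xs → Unique xs
  ¬Repeats⇒Unique []       _    = []
  ¬Repeats⇒Unique (x ∷ xs) ¬rep =
    All.tabulate head-fresh ∷
    ¬Repeats⇒Unique xs (λ (P , v , B , C , eq) → ¬rep (x ∷ P , v , B , C , cong (x ∷_) eq))
    where
    head-fresh : ∀ {y} → y ∈ xs → ¬ x ≡ y
    head-fresh y∈xs refl with B , C , eq ← ∈-∃++ y∈xs = ¬rep ([] , x , B , C , cong (x ∷_) eq)

  ++-≡-++ : ∀ (xs ys xs′ ys′ : List A) → xs ++ ys ≡ xs′ ++ ys′ →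
    (∃[ X ] xs′ ≡ xs ++ X × ys ≡ X ++ ys′) ⊎ (∃[ Y ] xs ≡ xs′ ++ Y × ys′ ≡ Y ++ ys)
  ++-≡-++ []       ys xs′       ys′ eq = inj₁ (xs′ , refl , eq)
  ++-≡-++ (x ∷ xs) ys []        ys′ eq = inj₂ (x ∷ xs , refl , sym eq)
  ++-≡-++ (x ∷ xs) ys (y ∷ xs′) ys′ eq with refl , eq′ ← ∷-injective eq
    with ++-≡-++ xs ys xs′ ys′ eq′
  ... | inj₁ (X , e₁ , e₂) = inj₁ (X , cong (x ∷_) e₁ , e₂)
  ... | inj₂ (Y , e₁ , e₂) = inj₂ (Y , cong (x ∷_) e₁ , e₂)

  drop-length-++ : ∀ (xs ys : List A) → drop (length xs) (xs ++ ys) ≡ ys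
  drop-length-++ []       ys = refl
  drop-length-++ (x ∷ xs) ys = drop-length-++ xs ys

  take-length-++ : ∀ (xs ys : List A) → take (length xs) (xs ++ ys) ≡ xs
  take-length-++ []       ys = refl
  take-length-++ (x ∷ xs) ys = cong (x ∷_) (take-length-++ xs ys)

  RotEq-++-swap : ∀ (xs ys : List A) → RotEq (xs ++ ys) (ys ++ xs)
  RotEq-++-swap xs ys =
    length xs , sym (cong₂ _++_ (drop-length-++ xs ys) (take-length-++ xs ys))

  RotEq-of-≡-++ : ∀ (xs ys xs′ ys′ : List A) → xs ++ ys ≡ xs′ ++ ys′ →
    RotEq (ys ++ xs) (ys′ ++ xs′)
  RotEq-of-≡-++ xs ys xs′ ys′ eq with ++-≡-++ xs ys xs′ ys′ eq
  ... | inj₁ (X , refl , refl) =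
    subst₂ RotEq (sym (++-assoc X ys′ xs)) (++-assoc ys′ xs X) (RotEq-++-swap X (ys′ ++ xs))
  ... | inj₂ (Y , refl , refl) =
    subst₂ RotEq (++-assoc ys xs′ Y) (sym (++-assoc Y ys xs′)) (RotEq-++-swap (ys ++ xs′) Y)

double-injective : ∀ a b → a + a ≡ b + b → a ≡ b
double-injective a b eq = trans (n≡⌊n+n/2⌋ a) (trans (cong ⌊_/2⌋ eq) (sym (n≡⌊n+n/2⌋ b)))

+-≡-bounds : ∀ {a b x y} → a ≤ x → b ≤ y → a + b ≡ x + y → a ≡ x × b ≡ y
+-≡-bounds {a} {b} {x} {y} a≤x b≤y eq = a≡x , +-cancelˡ-≡ a b y (trans eq (cong (_+ y) (sym a≡x)))
  where
  a≡x : a ≡ x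
  a≡x = ≤-antisym a≤x (+-cancelʳ-≤ y x a (subst (_≤ a + y) eq (+-monoʳ-≤ a b≤y)))

double-≡-of-≤ : ∀ {n} a b → n ≤ a + a → n ≤ b + b → a + b ≤ n → a + a ≡ n
double-≡-of-≤ {n} a b n≤2a n≤2b a+b≤n = ≤-antisym (+-cancelʳ-≤ n (a + a) n (begin
    (a + a) + n       ≤⟨ +-monoʳ-≤ (a + a) n≤2b ⟩
    (a + a) + (b + b) ≡⟨ interchange a b ⟩
    (a + b) + (a + b) ≤⟨ +-mono-≤ a+b≤n a+b≤n ⟩
    n + n             ∎)) n≤2a
  where
  open ≤-Reasoning
  interchange : ∀ a b → (a + a) + (b + b) ≡ (a + b) + (a + b)
  interchange = solve-∀

module _ (n : ℕ) where

  unitStep? : (u v : Fin n) → Dec (AddMod n 1 u v)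
  unitStep? u v = (toℕ v ≟ toℕ u + 1) ⊎-dec (toℕ v + n ≟ toℕ u + 1)

  step : Fin n → Fin n → ℕ
  step u v with unitStep? u v
  ... | yes _ = 1
  ... | no  _ = 2

  1≤step : ∀ u v → 1 ≤ step u v
  1≤step u v with unitStep? u v
  ... | yes _ = s≤s z≤n
  ... | no  _ = s≤s z≤n

  step≤2 : ∀ u v → step u v ≤ 2
  step≤2 u v with unitStep? u v
  ... | yes _ = s≤s z≤n
  ... | no  _ = s≤s (s≤s z≤n)

  AddMod-lift : ∀ {s} u v → AddMod n s u v → ∃[ k ] toℕ u + s ≡ toℕ v + k * n
  AddMod-lift u v (inj₁ eq) = 0 , trans (sym eq) (sym (+-identityʳ _))
  AddMod-lift u v (inj₂ eq) = 1 , trans (sym eq) (cong (toℕ v +_) (sym (*-identityˡ n)))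

  Bond-lift : ∀ {u v} → Bond n u v → ∃[ k ] toℕ u + step u v ≡ toℕ v + k * n
  Bond-lift {u} {v} bond with unitStep? u v | bond
  ... | yes unit  | _         = AddMod-lift u v unit
  ... | no  ¬unit | inj₁ unit = ⊥-elim (¬unit unit)
  ... | no  _     | inj₂ two  = AddMod-lift u v two

  step≡2⇒AddMod2 : ∀ {u v} → Bond n u v → step u v ≡ 2 → AddMod n 2 u v
  step≡2⇒AddMod2 {u} {v} bond step≡2 with unitStep? u v | bond
  step≡2⇒AddMod2 _ () | yes _ | _
  ... | no  ¬unit | inj₁ unit = ⊥-elim (¬unit unit)
  ... | no  _     | inj₂ two  = two

  AddMod-functional : ∀ {s} u {v w} → AddMod n s u v → AddMod n s u w → v ≡ w
  AddMod-functional _ (inj₁ e₁) (inj₁ e₂) = toℕ-injective (trans e₁ (sym e₂))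
  AddMod-functional _ {v} {w} (inj₁ e₁) (inj₂ e₂) =
    ⊥-elim (<⇒≱ (toℕ<n v) (subst (n ≤_) (trans (+-comm n (toℕ w)) (trans e₂ (sym e₁))) (m≤m+n n (toℕ w))))
  AddMod-functional _ {v} {w} (inj₂ e₁) (inj₁ e₂) =
    ⊥-elim (<⇒≱ (toℕ<n w) (subst (n ≤_) (trans (+-comm n (toℕ v)) (trans e₁ (sym e₂))) (m≤m+n n (toℕ v))))
  AddMod-functional _ {v} {w} (inj₂ e₁) (inj₂ e₂) =
    toℕ-injective (+-cancelʳ-≡ n (toℕ v) (toℕ w) (trans e₁ (sym e₂)))

  displacement : List (Fin n) → ℕ
  displacement []          = 0
  displacement (x ∷ [])    = 0
  displacement (x ∷ y ∷ r) = step x y + displacement (y ∷ r)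

  length≤displacement : ∀ x r → length r ≤ displacement (x ∷ r)
  length≤displacement x []      = z≤n
  length≤displacement x (y ∷ r) = +-mono-≤ (1≤step x y) (length≤displacement y r)

  displacement≤double : ∀ x r → displacement (x ∷ r) ≤ length r + length r
  displacement≤double x []      = z≤n
  displacement≤double x (y ∷ r) =
    subst (displacement (x ∷ y ∷ r) ≤_) (cong suc (sym (+-suc (length r) (length r))))
      (+-mono-≤ (step≤2 x y) (displacement≤double y r))

  ConsecBonds-++⁻ : ∀ P x Q → ConsecBonds n (P ++ x ∷ Q) →
    ConsecBonds n (P ++ x ∷ []) × ConsecBonds n (x ∷ Q)
  ConsecBonds-++⁻ []          x Q bonds       = tt , bonds
  ConsecBonds-++⁻ (p ∷ [])    x Q (b , bonds) = (b , tt) , bonds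
  ConsecBonds-++⁻ (p ∷ q ∷ P) x Q (b , bonds) with left , right ← ConsecBonds-++⁻ (q ∷ P) x Q bonds =
    (b , left) , right

  ConsecBonds-++⁺ : ∀ P x Q → ConsecBonds n (P ++ x ∷ []) → ConsecBonds n (x ∷ Q) →
    ConsecBonds n (P ++ x ∷ Q)
  ConsecBonds-++⁺ []          x Q _          right = right
  ConsecBonds-++⁺ (p ∷ [])    x Q (b , _)    right = b , right
  ConsecBonds-++⁺ (p ∷ q ∷ P) x Q (b , left) right = b , ConsecBonds-++⁺ (q ∷ P) x Q left right

  displacement-lift : ∀ x r y → ConsecBonds n (x ∷ r ++ y ∷ []) →
    ∃[ k ] toℕ x + displacement (x ∷ r ++ y ∷ []) ≡ toℕ y + k * n
  displacement-lift x [] y (b , _) with k , eq ← Bond-lift b =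
    k , trans (cong (toℕ x +_) (+-identityʳ _)) eq
  displacement-lift x (z ∷ r) y (b , bonds)
    with k₁ , e₁ ← Bond-lift b | k₂ , e₂ ← displacement-lift z r y bonds = k₂ + k₁ , (begin
      toℕ x + (step x z + D)          ≡⟨ sym (+-assoc (toℕ x) (step x z) D) ⟩
      (toℕ x + step x z) + D          ≡⟨ cong (_+ D) e₁ ⟩
      (toℕ z + k₁ * n) + D            ≡⟨ +-comm-middle (toℕ z) (k₁ * n) D ⟩
      (toℕ z + D) + k₁ * n            ≡⟨ cong (_+ k₁ * n) e₂ ⟩
      (toℕ y + k₂ * n) + k₁ * n       ≡⟨ +-assoc (toℕ y) (k₂ * n) (k₁ * n) ⟩
      toℕ y + (k₂ * n + k₁ * n)       ≡⟨ cong (toℕ y +_) (sym (*-distribʳ-+ n k₂ k₁)) ⟩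
      toℕ y + (k₂ + k₁) * n           ∎)
    where
    open ≡-Reasoning
    D = displacement (z ∷ r ++ y ∷ [])
    +-comm-middle : ∀ a b c → (a + b) + c ≡ (a + c) + b
    +-comm-middle = solve-∀

  closedWalk-n≤displacement : ∀ x r → ConsecBonds n (x ∷ r ++ x ∷ []) →
    n ≤ displacement (x ∷ r ++ x ∷ [])
  closedWalk-n≤displacement x r bonds
    with k , eq ← displacement-lift x r x bonds
    with k | +-cancelˡ-≡ (toℕ x) _ _ eq
  ... | zero  | D≡0 = ⊥-elim (<⇒≱ (subst (0 <_) D≡0 positive) z≤n)
    where
    positive : 0 < displacement (x ∷ r ++ x ∷ [])
    positive = ≤-trans (subst (0 <_) (sym (length-++-sucʳ r x [])) (s≤s z≤n))
                 (length≤displacement x (r ++ x ∷ []))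
  ... | suc k′ | D≡n+k′n = subst (n ≤_) (sym D≡n+k′n) (m≤m+n n (k′ * n))

  maximalDisplacement-∷ : ∀ v y s →
    displacement (v ∷ y ∷ s) ≡ suc (length s) + suc (length s) →
    step v y ≡ 2 × displacement (y ∷ s) ≡ length s + length s
  maximalDisplacement-∷ v y s eq = +-≡-bounds (step≤2 v y) (displacement≤double y s)
    (trans eq (cong suc (+-suc (length s) (length s))))

  maximalWalk-unique : ∀ v r₁ r₂ → length r₁ ≡ length r₂ →
    ConsecBonds n (v ∷ r₁) → ConsecBonds n (v ∷ r₂) →
    displacement (v ∷ r₁) ≡ length r₁ + length r₁ →
    displacement (v ∷ r₂) ≡ length r₂ + length r₂ → r₁ ≡ r₂
  maximalWalk-unique v [] [] _ _ _ _ _ = refl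
  maximalWalk-unique v (y₁ ∷ s₁) (y₂ ∷ s₂) len-eq (b₁ , bonds₁) (b₂ , bonds₂) d₁ d₂
    with two₁ , d₁′ ← maximalDisplacement-∷ v y₁ s₁ d₁ | two₂ , d₂′ ← maximalDisplacement-∷ v y₂ s₂ d₂
    with refl ← AddMod-functional v (step≡2⇒AddMod2 b₁ two₁) (step≡2⇒AddMod2 b₂ two₂) =
    cong (y₁ ∷_) (maximalWalk-unique y₁ s₁ s₂ (suc-injective len-eq) bonds₁ bonds₂ d₁′ d₂′)

  closedWalks-≡ : ∀ v r₁ r₂ →
    ConsecBonds n (v ∷ r₁ ++ v ∷ []) → ConsecBonds n (v ∷ r₂ ++ v ∷ []) →
    suc (length r₁) + suc (length r₂) ≤ n → r₁ ≡ r₂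
  closedWalks-≡ v r₁ r₂ bonds₁ bonds₂ short =
    ∷ʳ-injectiveˡ r₁ r₂ (maximalWalk-unique v (r₁ ++ v ∷ []) (r₂ ++ v ∷ [])
      (double-injective k₁ k₂ (trans 2k₁≡n (sym 2k₂≡n))) bonds₁ bonds₂
      (saturated r₁ bonds₁ 2k₁≡n) (saturated r₂ bonds₂ 2k₂≡n))
    where
    k₁ = length (r₁ ++ v ∷ [])
    k₂ = length (r₂ ++ v ∷ [])
    short′ : k₁ + k₂ ≤ n
    short′ = subst (_≤ n) (sym (cong₂ _+_ (length-∷ʳ r₁) (length-∷ʳ r₂))) short
      where
      length-∷ʳ : ∀ r → length (r ++ v ∷ []) ≡ suc (length r)
      length-∷ʳ r = trans (length-++ r) (+-comm (length r) 1)
    n≤2k : ∀ r → ConsecBonds n (v ∷ r ++ v ∷ []) → n ≤ length (r ++ v ∷ []) + length (r ++ v ∷ [])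
    n≤2k r bonds = ≤-trans (closedWalk-n≤displacement v r bonds) (displacement≤double v (r ++ v ∷ []))
    2k₁≡n : k₁ + k₁ ≡ n
    2k₁≡n = double-≡-of-≤ k₁ k₂ (n≤2k r₁ bonds₁) (n≤2k r₂ bonds₂) short′
    2k₂≡n : k₂ + k₂ ≡ n
    2k₂≡n = double-≡-of-≤ k₂ k₁ (n≤2k r₂ bonds₂) (n≤2k r₁ bonds₁) (subst (_≤ n) (+-comm k₁ k₂) short′)
    saturated : ∀ r → ConsecBonds n (v ∷ r ++ v ∷ []) →
      let k = length (r ++ v ∷ []) in k + k ≡ n → displacement (v ∷ r ++ v ∷ []) ≡ k + k
    saturated r bonds 2k≡n =
      ≤-antisym (displacement≤double v (r ++ v ∷ []))
        (subst (_≤ displacement (v ∷ r ++ v ∷ [])) (sym 2k≡n) (closedWalk-n≤displacement v r bonds))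

  circuit-rotate : ∀ A v W → IsCircuit n (A ++ v ∷ W) → ConsecBonds n (v ∷ (W ++ A) ++ v ∷ [])
  circuit-rotate []      v W circuit =
    subst (λ w → ConsecBonds n (v ∷ w ++ v ∷ [])) (sym (++-identityʳ W)) circuit
  circuit-rotate (a ∷ A) v W circuit =
    subst (λ w → ConsecBonds n (v ∷ w)) (sym (++-assoc W (a ∷ A) (v ∷ [])))
      (ConsecBonds-++⁺ (v ∷ W) a (A ++ v ∷ []) (proj₂ halves) (proj₁ halves))
    where
    halves = ConsecBonds-++⁻ (a ∷ A) v (W ++ a ∷ [])
      (subst (λ w → ConsecBonds n (a ∷ w)) (++-assoc A (v ∷ W) (a ∷ [])) circuit)

  length-rotate : ∀ (A : List (Fin n)) v W → length (A ++ v ∷ W) ≡ suc (length (W ++ A))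
  length-rotate A v W = trans (length-++-sucʳ A v W) (cong suc (length-++-comm A W))

  circuit-¬Repeats : ∀ c → IsCircuit n c → length c ≤ n → Primitive c → ¬ Repeats c
  circuit-¬Repeats c circuit short c-primitive (A , v , B , C , refl) =
    c-primitive (A ++ v ∷ C) 2 (s≤s (s≤s z≤n)) square
    where
    open ≡-Reasoning
    closed : ConsecBonds n ((v ∷ B) ++ v ∷ (C ++ A) ++ v ∷ [])
    closed = subst (λ w → ConsecBonds n (v ∷ w)) reassoc (circuit-rotate A v (B ++ v ∷ C) circuit)
      where
      reassoc : ((B ++ v ∷ C) ++ A) ++ v ∷ [] ≡ B ++ v ∷ (C ++ A) ++ v ∷ []
      reassoc = trans (cong (_++ v ∷ []) (++-assoc B (v ∷ C) A)) (++-assoc B (v ∷ C ++ A) (v ∷ []))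
    halves = ConsecBonds-++⁻ (v ∷ B) v ((C ++ A) ++ v ∷ []) closed
    length-split : length (A ++ v ∷ B ++ v ∷ C) ≡ suc (length B) + suc (length (C ++ A))
    length-split = begin
      length (A ++ v ∷ B ++ v ∷ C)            ≡⟨ length-rotate A v (B ++ v ∷ C) ⟩
      suc (length ((B ++ v ∷ C) ++ A))        ≡⟨ cong (λ w → suc (length w)) (++-assoc B (v ∷ C) A) ⟩
      suc (length (B ++ v ∷ C ++ A))          ≡⟨ cong suc (length-++-sucʳ B v (C ++ A)) ⟩
      suc (suc (length (B ++ C ++ A)))        ≡⟨ cong (λ m → suc (suc m)) (length-++ B) ⟩
      suc (suc (length B + length (C ++ A)))  ≡⟨ cong suc (+-suc (length B) (length (C ++ A))) ⟨
      suc (length B) + suc (length (C ++ A))  ∎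
    B≡CA : B ≡ C ++ A
    B≡CA = closedWalks-≡ v B (C ++ A) (proj₁ halves) (proj₂ halves) (subst (_≤ n) length-split short)
    square : A ++ v ∷ B ++ v ∷ C ≡ concat (replicate 2 (A ++ v ∷ C))
    square = begin
      A ++ v ∷ B ++ v ∷ C                 ≡⟨ cong (λ w → A ++ v ∷ w ++ v ∷ C) B≡CA ⟩
      A ++ v ∷ (C ++ A) ++ v ∷ C          ≡⟨ cong (λ w → A ++ v ∷ w) (++-assoc C A (v ∷ C)) ⟩
      A ++ v ∷ C ++ A ++ v ∷ C            ≡⟨ ++-assoc A (v ∷ C) (A ++ v ∷ C) ⟨
      (A ++ v ∷ C) ++ A ++ v ∷ C          ≡⟨ cong ((A ++ v ∷ C) ++_) (++-identityʳ (A ++ v ∷ C)) ⟨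
      concat (replicate 2 (A ++ v ∷ C))   ∎

  sharedVertex⇒RotEq : ∀ {c₁ c₂ v} → IsCircuit n c₁ → IsCircuit n c₂ →
    length c₁ + length c₂ ≤ n → v ∈ c₁ → v ∈ c₂ → RotEq c₁ c₂
  sharedVertex⇒RotEq {v = v} circuit₁ circuit₂ short v∈c₁ v∈c₂
    with A₁ , W₁ , refl ← ∈-∃++ v∈c₁ | A₂ , W₂ , refl ← ∈-∃++ v∈c₂ =
    RotEq-of-≡-++ (v ∷ W₁) A₁ (v ∷ W₂) A₂ (cong (v ∷_)
      (closedWalks-≡ v (W₁ ++ A₁) (W₂ ++ A₂)
        (circuit-rotate A₁ v W₁ circuit₁) (circuit-rotate A₂ v W₂ circuit₂)
        (subst (_≤ n) (cong₂ _+_ (length-rotate A₁ v W₁) (length-rotate A₂ v W₂)) short)))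

  length≤orbitLength : ∀ {c} γ → c ∈ γ → length c ≤ orbitLength {n} γ
  length≤orbitLength (c ∷ γ) (here refl) = m≤m+n (length c) _
  length≤orbitLength (d ∷ γ) (there c∈γ) = ≤-trans (length≤orbitLength γ c∈γ) (m≤n+m _ (length d))

  shortPseudoOrbit-unique : ∀ γ → All (IsCircuit n) γ → All Primitive γ →
    AllPairs (λ c d → ¬ RotEq c d) γ → orbitLength γ ≤ n → Unique (visits γ)
  shortPseudoOrbit-unique [] _ _ _ _ = []
  shortPseudoOrbit-unique (c ∷ γ) (circuit ∷ circuits) (c-primitive ∷ primitives)
                          (distinct ∷ distincts) short =
    Unique.++⁺ (¬Repeats⇒Unique c (circuit-¬Repeats c circuit (m+n≤o⇒m≤o (length c) short) c-primitive))
               (shortPseudoOrbit-unique γ circuits primitives distincts (m+n≤o⇒n≤o (length c) short))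
               disjoint
    where
    disjoint : ∀ {v} → ¬ (v ∈ c × v ∈ concat γ)
    disjoint (v∈c , v∈γ) with d , v∈d , d∈γ ← ∈-concat⁻′ γ v∈γ =
      All.lookup distinct d∈γ (sharedVertex⇒RotEq circuit (All.lookup circuits d∈γ)
        (≤-trans (+-monoʳ-≤ (length c) (length≤orbitLength γ d∈γ)) short) v∈c v∈d)

proposition4 : (n : ℕ) → 2 < n → (γ : List (List (Fin n))) →
    PrimitivePseudoOrbit n γ → 0 < orbitLength γ → orbitLength γ ≤ n →
    Unique (visits γ)
proposition4 n _ γ orbit _ short =
  shortPseudoOrbit-unique n γ circuits allPrimitive distinct short
  where open PrimitivePseudoOrbit orbit
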